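{- Let $D$ be a dictionary, let $s$ and $s'$ be states of $\mathrm{AC}(D)$ with $s \neq \varepsilon$, and let $v = \pi^{ -1}(s)$ and $v' = \pi^{ -1}(s')$ be the corresponding trunk nodes of $\mathrm{DAWG}(D)$. Then $s' = \mathsf{flink}(s)$ if and only if there exists an integer $k \geq 1$ such that $v' = \mathsf{slink}^{k}(v)$ and, when $k \geq 2$, $\mathsf{slink}^{i}(v)$ is a non-trunk node for all $1 \leq i < k$.
   Context: Strings are over a finite alphabet $\Sigma$. A dictionary is a finite set $D = \{p_1, \dots, p_r\}$ of nonempty strings. $\mathrm{Pref}(D)$ is the set of all prefixes (including $\varepsilon$) of strings of $D$, and $\mathrm{Substr}(D)$ the set of all their substrings. The Aho–Corasick automaton $\mathrm{AC}(D)$ has state set $\mathrm{Pref}(D)$ (each state is identified with the string spelled from the root $\varepsilon$); for a state $s \neq \varepsilon$, $\mathsf{flink}(s)$ is the longest proper suffix of $s$ that belongs to $\mathrm{Pref}(D)$. For a string $x$ let $\mathrm{endPos}_D(x) = \{(i,j) : x = p_i[j-|x|+1 : j],\ |x| \leq j \leq |p_i|\}$. For $x, y \in \mathrm{Substr}(D)$ write $x \equiv_D y$ iff $\mathrm{endPos}_D(x) = \mathrm{endPos}_D(y)$, and let $[x]_D$ be the equivalence class of $x$. The DAWG of $D$, $\mathrm{DAWG}(D)$, has node set $\{[x]_D : x \in \mathrm{Substr}(D)\}$, edges $([x]_D, c, [xc]_D)$ for $x, xc \in \mathrm{Substr}(D)$, $c \in \Sigma$, and source $[\varepsilon]_D$.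 For a node $[x]_D$ other than the source, $\mathsf{slink}([x]_D) = [y]_D$ where $y$ is the longest suffix of $x$ with $y \not\equiv_D x$; $\mathsf{slink}^1 = \mathsf{slink}$ and $\mathsf{slink}^{i} = \mathsf{slink} \circ \mathsf{slink}^{i-1}$. A node $v$ is a trunk node if $v = [w]_D$ for some $w \in \mathrm{Pref}(D)$ (equivalently, some path from the source to $v$ spells a string in $\mathrm{Pref}(D)$), and a non-trunk node otherwise. Each trunk node contains exactly one element of $\mathrm{Pref}(D)$; $\pi(v)$ denotes this element (a state of $\mathrm{AC}(D)$), and $\pi$ is a bijection from trunk nodes to states, with inverse $\pi^{ -1}(s) = [s]_D$. -}

module Defs where

open import Data.Nat using (ℕ; zero; suc; _≤_; _<_; _∸_)
open import Data.Fin using (Fin)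
open import Data.List using (List; []; _∷_; length; lookup; take; drop; _++_)
open import Data.List.Membership.Propositional using (_∈_)
open import Data.Product using (Σ; ∃; ∃-syntax; _×_; _,_)
open import Relation.Binary.PropositionalEquality using (_≡_; _≢_)
open import Relation.Nullary using (¬_)
open import Function.Bundles using (_⇔_)

Word : ℕ → Set
Word σ = List (Fin σ)

-- A dictionary is given as a list of strings (required distinct and
-- nonempty in the theorem); p_i = lookup D i.
Dict : ℕ → Set
Dict σ = List (Word σ)

module _ {σ : ℕ} where

  IsPrefix : Word σ → Word σ → Set
  IsPrefix w p = ∃[ u ] (w ++ u ≡ p)

  IsSuffix : Word σ → Word σ → Set
  IsSuffix y x = ∃[ u ] (u ++ y ≡ x)

  InPref : Dict σ → Word σ → Set
  InPref D w = ∃[ p ] (p ∈ D × IsPrefix w p)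

  -- (i , j) ∈ endPos_D(x):  |x| ≤ j ≤ |p_i| and x = p_i[j-|x|+1 : j]
  EndPos : (D : Dict σ) → Word σ → Fin (length D) → ℕ → Set
  EndPos D x i j =
    length x ≤ j × j ≤ length (lookup D i) ×
    x ≡ take (length x) (drop (j ∸ length x) (lookup D i))

  EquivD : Dict σ → Word σ → Word σ → Set
  EquivD D x y = ∀ i j → EndPos D x i j ⇔ EndPos D y i j

  Flink : Dict σ → Word σ → Word σ → Set
  Flink D s t =
    (IsSuffix t s × length t < length s × InPref D t) ×
    (∀ z → IsSuffix z s → length z < length s → InPref D z → length z ≤ length t)

  -- DAWG nodes are represented by representative strings (node [x]_D).
  -- slink([x]_D) = [y]_D where y is the longest suffix of x with y ≢_D x.
  Slink : Dict σ → Word σ → Word σ → Set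
  Slink D x y =
    (IsSuffix y x × ¬ EquivD D y x) ×
    (∀ z → IsSuffix z x → length y < length z → EquivD D z x)

  data SlinkIter (D : Dict σ) : ℕ → Word σ → Word σ → Set where
    iter-zero : ∀ {x} → SlinkIter D zero x x
    iter-suc  : ∀ {k x y z} → Slink D x y → SlinkIter D k y z → SlinkIter D (suc k) x z

  Trunk : Dict σ → Word σ → Set
  Trunk D x = ∃[ w ] (InPref D w × EquivD D w x)

module Submission where

-- Fix a state s ∈ Pref(D), a prefix of some pattern p_i.  Every suffix of s
-- ends at position |s| of p_i, and conversely every string D-equivalent to a
-- suffix of s ends there too, hence is itself a suffix of s.  Iterating slink
-- from s therefore walks down the classes of the suffixes of s in order of
-- decreasing length: every suffix z of s is met, equivalent to an iterate
-- slink^k(s) with all earlier iterates longer than z (slink-chain-meets).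
-- Since a trunk node's Pref-element is the longest string in its class
-- (pref-longest), the first trunk node after s on this chain is exactly the
-- class of the longest proper suffix of s in Pref(D), i.e. of flink(s).

open import Defs
open import Data.Nat using (ℕ; zero; suc; _+_; _∸_; _⊓_; _≤_; _<_; z≤n; s≤s; _≤?_)
open import Data.Nat.Properties
open import Data.Fin using (Fin)
import Data.Fin.Properties as FinP
open import Data.List using (List; []; _∷_; _++_; length; lookup; take; drop; [_])
open import Data.List.Properties using (length-++; length-take; take++drop≡id; ++-assoc; ≡-dec; ∷-injectiveˡ; ∷-injectiveʳ)
open import Data.List.Relation.Unary.All using (All)
open import Data.List.Relation.Unary.Unique.Propositional using (Unique)
open import Data.List.Relation.Unary.Any using (index)
open import Data.List.Relation.Unary.Any.Properties using (lookup-index)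
open import Data.Product using (∃-syntax; _×_; _,_; proj₁; proj₂; uncurry)
open import Data.Sum using (_⊎_; inj₁; inj₂)
open import Data.Empty using (⊥; ⊥-elim)
open import Relation.Binary.PropositionalEquality using (_≡_; _≢_; refl; sym; trans; cong; cong₂; subst; module ≡-Reasoning)
open import Relation.Binary.Definitions using (tri<; tri≈; tri>)
open import Relation.Nullary using (¬_; Dec; yes; no)
open import Relation.Nullary.Decidable using (_×-dec_; _→-dec_; map′)
open import Function.Base using (_∘_)
open import Function.Bundles using (_⇔_; mk⇔; Equivalence)

module _ {σ : ℕ} where

  drop-length-++ : (a b : Word σ) → drop (length a) (a ++ b) ≡ b
  drop-length-++ []      b = refl
  drop-length-++ (_ ∷ a) b = drop-length-++ a b

  take-length-++ : (a b : Word σ) → take (length a) (a ++ b) ≡ a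
  take-length-++ []      b = refl
  take-length-++ (c ∷ a) b = cong (c ∷_) (take-length-++ a b)

  ++-prefix-unique : (a b c d : Word σ) → length a ≡ length c → a ++ b ≡ c ++ d → a ≡ c
  ++-prefix-unique []      b []      d _   _ = refl
  ++-prefix-unique (x ∷ a) b (y ∷ c) d len e =
    cong₂ _∷_ (∷-injectiveˡ e) (++-prefix-unique a b c d (suc-injective len) (∷-injectiveʳ e))

  ++-tails-comparable : (a x b y : Word σ) → a ++ x ≡ b ++ y → IsSuffix x y ⊎ IsSuffix y x
  ++-tails-comparable []      x b       y e = inj₂ (b , sym e)
  ++-tails-comparable (c ∷ a) x []      y e = inj₁ (c ∷ a , e)
  ++-tails-comparable (c ∷ a) x (_ ∷ b) y e = ++-tails-comparable a x b y (∷-injectiveʳ e)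

  suffix-refl : {x : Word σ} → IsSuffix x x
  suffix-refl = [] , refl

  suffix-trans : {z y x : Word σ} → IsSuffix z y → IsSuffix y x → IsSuffix z x
  suffix-trans {z} (u , refl) (v , refl) = v ++ u , ++-assoc v u z

  suffix-length : {y x : Word σ} → IsSuffix y x → length y ≤ length x
  suffix-length {y} (u , refl) = subst (length y ≤_) (sym (length-++ u)) (m≤n+m (length y) (length u))

  suffix-full : {y x : Word σ} → IsSuffix y x → length x ≤ length y → y ≡ x
  suffix-full ([]    , e)    _  = e
  suffix-full (c ∷ u , refl) le = ⊥-elim (<⇒≱ (s≤s (suffix-length (u , refl))) le)

  suffix-proper-or-equal : {y x : Word σ} → IsSuffix y x → length y < length x ⊎ y ≡ x
  suffix-proper-or-equal ys with m≤n⇒m<n∨m≡n (suffix-length ys)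
  ... | inj₁ lt = inj₁ lt
  ... | inj₂ eq = inj₂ (suffix-full ys (≤-reflexive (sym eq)))

  suffixes-nested : {z w x : Word σ} → IsSuffix z x → IsSuffix w x → length z ≤ length w → IsSuffix z w
  suffixes-nested {z} {w} (u , e) (v , e') le with ++-tails-comparable u z v w (trans e (sym e'))
  ... | inj₁ zw = zw
  ... | inj₂ wz = subst (IsSuffix z) (sym (suffix-full wz le)) suffix-refl

  suffixes-equal : {z w x : Word σ} → IsSuffix z x → IsSuffix w x → length z ≡ length w → z ≡ w
  suffixes-equal zx wx eq = suffix-full (suffixes-nested zx wx (≤-reflexive eq)) (≤-reflexive (sym eq))

  -- For a decidable property P failing on ε, every string x has a longest
  -- suffix y violating P; all longer suffixes of x satisfy P.  (With
  -- P z = z ≡_D x this is exactly slink.)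
  longest-suffix-outside : (P : Word σ → Set) → (∀ w → Dec (P w)) → ¬ P [] → (x : Word σ) →
    ∃[ y ] ((IsSuffix y x × ¬ P y) × (∀ z → IsSuffix z x → length y < length z → P z))
  longest-suffix-outside P P? ¬P[] x = search x suffix-refl (λ z zx lt → ⊥-elim (<⇒≱ lt (suffix-length zx)))
    where
    -- Invariant: all suffixes of x longer than w satisfy P.
    search : (w : Word σ) → IsSuffix w x → (∀ z → IsSuffix z x → length w < length z → P z) →
      ∃[ y ] ((IsSuffix y x × ¬ P y) × (∀ z → IsSuffix z x → length y < length z → P z))
    search [] wx above = [] , (wx , ¬P[]) , above
    search (c ∷ w) cwx above with P? (c ∷ w)
    ... | no ¬Pcw = c ∷ w , (cwx , ¬Pcw) , above
    ... | yes Pcw = search w wx above′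
      where
      wx : IsSuffix w x
      wx = suffix-trans ([ c ] , refl) cwx
      above′ : ∀ z → IsSuffix z x → length w < length z → P z
      above′ z zx lt with m≤n⇒m<n∨m≡n lt
      ... | inj₁ longer = above z zx longer
      ... | inj₂ eq     = subst P (suffixes-equal cwx zx eq) Pcw

module _ {σ : ℕ} (D : Dict σ) where

  Occurs : Word σ → Fin (length D) → ℕ → Set
  Occurs x i j = ∃[ a ] ∃[ b ] (a ++ x ++ b ≡ lookup D i × length a + length x ≡ j)

  endPos⇒occurs : ∀ {x i j} → EndPos D x i j → Occurs x i j
  endPos⇒occurs {x} {i} {j} (|x|≤j , j≤|p| , x≡window) = take n p , drop (length x) rest , split , len
    where
    p : Word σ
    p = lookup D i
    n : ℕ
    n = j ∸ length x
    rest : Word σ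
    rest = drop n p
    split : take n p ++ x ++ drop (length x) rest ≡ p
    split = begin
      take n p ++ x ++ drop (length x) rest
        ≡⟨ cong (λ w → take n p ++ w ++ drop (length x) rest) x≡window ⟩
      take n p ++ take (length x) rest ++ drop (length x) rest
        ≡⟨ cong (take n p ++_) (take++drop≡id (length x) rest) ⟩
      take n p ++ rest
        ≡⟨ take++drop≡id n p ⟩
      p ∎
      where open ≡-Reasoning
    len : length (take n p) + length x ≡ j
    len = begin
      length (take n p) + length x ≡⟨ cong (_+ length x) (length-take n p) ⟩
      (n ⊓ length p) + length x    ≡⟨ cong (_+ length x) (m≤n⇒m⊓n≡m (≤-trans (m∸n≤m j (length x)) j≤|p|)) ⟩
      n + length x                 ≡⟨ m∸n+n≡m |x|≤j ⟩
      j ∎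
      where open ≡-Reasoning

  occurs⇒endPos : ∀ {x i j} → Occurs x i j → EndPos D x i j
  occurs⇒endPos {x} {i} (a , b , e , refl) =
    m≤n+m (length x) (length a) ,
    subst (λ p → length a + length x ≤ length p) e bound ,
    subst (λ p → x ≡ take (length x) (drop (length a + length x ∸ length x) p)) e (sym window)
    where
    bound : length a + length x ≤ length (a ++ x ++ b)
    bound = subst (length a + length x ≤_) (sym (trans (length-++ a) (cong (length a +_) (length-++ x))))
              (+-monoʳ-≤ (length a) (m≤m+n (length x) (length b)))
    window : take (length x) (drop (length a + length x ∸ length x) (a ++ x ++ b)) ≡ x
    window = begin
      take (length x) (drop (length a + length x ∸ length x) (a ++ x ++ b))
        ≡⟨ cong (λ k → take (length x) (drop k (a ++ x ++ b))) (m+n∸n≡m (length a) (length x)) ⟩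
      take (length x) (drop (length a) (a ++ x ++ b))
        ≡⟨ cong (take (length x)) (drop-length-++ a (x ++ b)) ⟩
      take (length x) (x ++ b)
        ≡⟨ take-length-++ x b ⟩
      x ∎
      where open ≡-Reasoning

  prefix-endPos : ∀ {s u i} → s ++ u ≡ lookup D i → EndPos D s i (length s)
  prefix-endPos {u = u} e = occurs⇒endPos ([] , u , e , refl)

  ends-inside-prefix : ∀ {s u w i} → s ++ u ≡ lookup D i → EndPos D w i (length s) → IsSuffix w s
  ends-inside-prefix {s} {u} {w} s-prefix w-ends with endPos⇒occurs w-ends
  ... | a , b , e , len =
    a , ++-prefix-unique (a ++ w) b s u (trans (length-++ a) len) (trans (++-assoc a w b) (trans e (sym s-prefix)))

  pref-entry : ∀ {w} → InPref D w → ∃[ i ] ∃[ u ] (w ++ u ≡ lookup D i)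
  pref-entry (p , p∈D , u , e) = index p∈D , u , trans e (lookup-index p∈D)

  _⊆ᴱ_ : Word σ → Word σ → Set
  x ⊆ᴱ y = ∀ i j → EndPos D x i j → EndPos D y i j

  suffix⇒⊆ᴱ : ∀ {y x} → IsSuffix y x → x ⊆ᴱ y
  suffix⇒⊆ᴱ {y} (u , refl) i j x-ends with endPos⇒occurs x-ends
  ... | a , b , e , len = occurs⇒endPos (a ++ u , b , e′ , len′)
    where
    e′ : (a ++ u) ++ y ++ b ≡ lookup D i
    e′ = trans (++-assoc a u (y ++ b)) (trans (cong (a ++_) (sym (++-assoc u y b))) e)
    len′ : length (a ++ u) + length y ≡ j
    len′ = trans (cong (_+ length y) (length-++ a))
             (trans (+-assoc (length a) (length u) (length y)) (trans (cong (length a +_) (sym (length-++ u))) len))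

  ≡D-intro : ∀ {x y} → x ⊆ᴱ y → y ⊆ᴱ x → EquivD D x y
  ≡D-intro f g i j = mk⇔ (f i j) (g i j)

  ≡D-to : ∀ {x y} → EquivD D x y → x ⊆ᴱ y
  ≡D-to e i j = Equivalence.to (e i j)

  ≡D-from : ∀ {x y} → EquivD D x y → y ⊆ᴱ x
  ≡D-from e i j = Equivalence.from (e i j)

  ≡D-refl : ∀ {x} → EquivD D x x
  ≡D-refl = ≡D-intro (λ _ _ e → e) (λ _ _ e → e)

  ≡D-sym : ∀ {x y} → EquivD D x y → EquivD D y x
  ≡D-sym e = ≡D-intro (≡D-from e) (≡D-to e)

  ≡D-trans : ∀ {x y z} → EquivD D x y → EquivD D y z → EquivD D x z
  ≡D-trans e f = ≡D-intro (λ i j → ≡D-to f i j ∘ ≡D-to e i j) (λ i j → ≡D-from e i j ∘ ≡D-from f i j)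

  equiv-sandwich : ∀ {z y x} → IsSuffix z y → IsSuffix y x → EquivD D z x → EquivD D y x
  equiv-sandwich zy yx z≈x =
    ≡D-intro (λ i j y-ends → ≡D-to z≈x i j (suffix⇒⊆ᴱ zy i j y-ends)) (suffix⇒⊆ᴱ yx)

  pref-longest : ∀ {w w′} → InPref D w → EquivD D w′ w → length w′ ≤ length w
  pref-longest wP w′≈w with pref-entry wP
  ... | i , _ , w-prefix = proj₁ (≡D-from w′≈w i _ (prefix-endPos w-prefix))

  -- D-equivalence is decidable: end positions in p_i are bounded by |p_i|.
  endPos? : ∀ x i j → Dec (EndPos D x i j)
  endPos? x i j = (length x ≤? j) ×-dec ((j ≤? length (lookup D i)) ×-dec
                    ≡-dec FinP._≟_ x (take (length x) (drop (j ∸ length x) (lookup D i))))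

  ⊆ᴱ? : ∀ x y → Dec (x ⊆ᴱ y)
  ⊆ᴱ? x y = FinP.all? λ i →
    map′ (λ below j x-ends → below (s≤s (proj₁ (proj₂ x-ends))) x-ends) (λ all {j} _ → all j)
      (allUpTo? (λ j → endPos? x i j →-dec endPos? y i j) (suc (length (lookup D i))))

  ≡D? : ∀ x y → Dec (EquivD D x y)
  ≡D? x y = map′ (uncurry ≡D-intro) (λ e → ≡D-to e , ≡D-from e) (⊆ᴱ? x y ×-dec ⊆ᴱ? y x)

  -- For nonempty D, ε (ending at position 0) is not equivalent to a nonempty string.
  ε-not-equiv : Fin (length D) → ∀ c x → ¬ EquivD D [] (c ∷ x)
  ε-not-equiv i c x ε≈cx with ≡D-to ε≈cx i 0 (z≤n , z≤n , refl)
  ... | () , _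

  slink-exists : Fin (length D) → ∀ c x → ∃[ y ] Slink D (c ∷ x) y
  slink-exists i c x =
    longest-suffix-outside (λ z → EquivD D z (c ∷ x)) (λ z → ≡D? z (c ∷ x)) (ε-not-equiv i c x) (c ∷ x)

  slink-suffix : ∀ {x y} → Slink D x y → IsSuffix y x
  slink-suffix ((yx , _) , _) = yx

  slink-unique : ∀ {x y y′} → Slink D x y → Slink D x y′ → y ≡ y′
  slink-unique {y = y} {y′} ((yx , y≉x) , above) ((y′x , y′≉x) , above′) with <-cmp (length y) (length y′)
  ... | tri< lt _  _  = ⊥-elim (y′≉x (above y′ y′x lt))
  ... | tri≈ _  eq _  = suffixes-equal yx y′x eq
  ... | tri> _  _  gt = ⊥-elim (y≉x (above′ y yx gt))

  slink-shorter : ∀ {x y} → Slink D x y → length y < length x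
  slink-shorter ((yx , y≉x) , _) with suffix-proper-or-equal yx
  ... | inj₁ lt   = lt
  ... | inj₂ refl = ⊥-elim (y≉x ≡D-refl)

  iterate-suffix : ∀ {k x y} → SlinkIter D k x y → IsSuffix y x
  iterate-suffix iter-zero        = suffix-refl
  iterate-suffix (iter-suc sl it) = suffix-trans (iterate-suffix it) (slink-suffix sl)

  iterate-unique : ∀ {k x y y′} → SlinkIter D k x y → SlinkIter D k x y′ → y ≡ y′
  iterate-unique iter-zero        iter-zero          = refl
  iterate-unique (iter-suc sl it) (iter-suc sl′ it′) with slink-unique sl sl′
  ... | refl = iterate-unique it it′

  iterate-not-equiv : ∀ {k x y} → SlinkIter D (suc k) x y → ¬ EquivD D y x
  iterate-not-equiv (iter-suc ((x₁x , x₁≉x) , _) it) y≈x = x₁≉x (equiv-sandwich (iterate-suffix it) x₁x y≈x)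

  MetAt : Word σ → Word σ → ℕ → Word σ → Set
  MetAt x z k y = SlinkIter D k x y × EquivD D z y ×
                  (∀ i → i < k → ∀ x′ → SlinkIter D i x x′ → length z < length x′)

  slink-chain-meets : Fin (length D) → ∀ n x → length x ≤ n → ∀ z → IsSuffix z x → ∃[ k ] ∃[ y ] MetAt x z k y
  slink-chain-meets i _ [] _ z z⊑ε =
    0 , [] , iter-zero , subst (λ w → EquivD D w []) (sym (suffix-full z⊑ε z≤n)) ≡D-refl , λ _ ()
  slink-chain-meets i (suc n) (c ∷ x) (s≤s |x|≤n) z zx with slink-exists i c x
  ... | x₁ , sl@((x₁x , _) , above) with length z ≤? length x₁
  ... | no  z≰x₁ = 0 , c ∷ x , iter-zero , above z zx (≰⇒> z≰x₁) , λ _ ()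
  ... | yes z≤x₁ with slink-chain-meets i n x₁ (≤-pred (≤-trans (slink-shorter sl) (s≤s |x|≤n))) z
                                          (suffixes-nested zx x₁x z≤x₁)
  ...   | k , y , it , z≈y , longer = suc k , y , iter-suc sl it , z≈y , longer′
    where
    longer′ : ∀ j → j < suc k → ∀ x′ → SlinkIter D j (c ∷ x) x′ → length z < length x′
    longer′ zero    _         _  iter-zero            = ≤-<-trans z≤x₁ (slink-shorter sl)
    longer′ (suc j) (s≤s j<k) x′ (iter-suc sl′ it′) with slink-unique sl sl′
    ... | refl = longer j j<k x′ it′

  FirstTrunkOnChain : Word σ → Word σ → Set
  FirstTrunkOnChain s t =
    ∃[ k ] (1 ≤ k × (∃[ y ] (SlinkIter D k s y × EquivD D y t))
        × (∀ j → 1 ≤ j → j < k → ∀ z → SlinkIter D j s z → ¬ Trunk D z))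

  -- From now on s is a prefix of p_i, i.e. a state of AC(D).
  module _ {s u : Word σ} {i : Fin (length D)} (s-prefix : s ++ u ≡ lookup D i) where

    -- Strings equivalent to a suffix of s are suffixes of s: all end at position |s| of p_i.
    equiv-suffix : ∀ {x w} → IsSuffix x s → EquivD D w x → IsSuffix w s
    equiv-suffix xs w≈x =
      ends-inside-prefix s-prefix (≡D-from w≈x i _ (suffix⇒⊆ᴱ xs i _ (prefix-endPos s-prefix)))

    iterate-class-proper : ∀ {k y w} → SlinkIter D (suc k) s y → EquivD D w y → IsSuffix w s × length w < length s
    iterate-class-proper it w≈y with equiv-suffix (iterate-suffix it) w≈y
    ... | ws with suffix-proper-or-equal ws
    ...   | inj₁ w<s = ws , w<s
    ...   | inj₂ w≡s = ⊥-elim (iterate-not-equiv it (≡D-sym (subst (λ v → EquivD D v _) w≡s w≈y)))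

    meets : ∀ z → IsSuffix z s → ∃[ k ] ∃[ y ] MetAt s z k y
    meets = slink-chain-meets i (length s) s ≤-refl

    flink⇒chain : ∀ {t} → Flink D s t → FirstTrunkOnChain s t
    flink⇒chain {t} ((ts , t<s , tP) , maximal) with meets t ts
    ... | zero  , _ , iter-zero , t≈s , _ = ⊥-elim (<⇒≱ t<s (pref-longest tP (≡D-sym t≈s)))
    ... | suc k , y , it , t≈y , longer = suc k , s≤s z≤n , (y , it , ≡D-sym t≈y) , non-trunk
      where
      -- A trunk node strictly between s and [t] would carry a longer proper suffix in Pref(D).
      non-trunk : ∀ j → 1 ≤ j → j < suc k → ∀ z → SlinkIter D j s z → ¬ Trunk D z
      non-trunk (suc j) _ j<k z itz (w , wP , w≈z) with iterate-class-proper itz w≈z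
      ... | ws , w<s = <⇒≱ (longer (suc j) j<k z itz)
                         (≤-trans (pref-longest wP (≡D-sym w≈z)) (maximal w ws w<s wP))

    chain⇒flink : ∀ {s′} → InPref D s′ → FirstTrunkOnChain s s′ → Flink D s s′
    chain⇒flink {s′} s′P (suc k , _ , (y , it , y≈s′) , non-trunk) =
      (proj₁ s′-proper , proj₂ s′-proper , s′P) , maximal
      where
      s′-proper : IsSuffix s′ s × length s′ < length s
      s′-proper = iterate-class-proper it (≡D-sym y≈s′)
      maximal : ∀ z → IsSuffix z s → length z < length s → InPref D z → length z ≤ length s′
      maximal z zs z<s zP with meets z zs
      ... | k′ , y′ , it′ , z≈y′ , longer with <-cmp k′ (suc k)
      ... | tri< early _ _ = ⊥-elim (met-early early it′ z≈y′)
        where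
        -- z cannot be met before step k: not at s (z is proper), nor at a non-trunk node.
        met-early : ∀ {k′ y′} → k′ < suc k → SlinkIter D k′ s y′ → EquivD D z y′ → ⊥
        met-early _   iter-zero        z≈s = <⇒≱ z<s (pref-longest zP (≡D-sym z≈s))
        met-early m<k it″@(iter-suc _ _) z≈y″ = non-trunk _ (s≤s z≤n) m<k _ it″ (z , zP , z≈y″)
      ... | tri≈ _ refl _ =
        pref-longest s′P (≡D-trans z≈y′ (subst (λ v → EquivD D v s′) (sym (iterate-unique it′ it)) y≈s′))
      ... | tri> _ _ later =
        <⇒≤ (<-≤-trans (longer (suc k) later y it) (pref-longest s′P y≈s′))

lemma1 : (σ : ℕ) (D : Dict σ) → All (λ p → p ≢ []) D → Unique D →
    (s s' : Word σ) → InPref D s → InPref D s' → s ≢ [] →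
    Flink D s s' ⇔
      (∃[ k ] (1 ≤ k × (∃[ y ] (SlinkIter D k s y × EquivD D y s'))
        × (∀ i → 1 ≤ i → i < k → ∀ z → SlinkIter D i s z → ¬ Trunk D z)))
lemma1 σ D _ _ s s' sP s'P _ with pref-entry D sP
... | _ , _ , s-prefix = mk⇔ (flink⇒chain D s-prefix) (chain⇒flink D s-prefix s'P)
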